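{- Let $G$ be a finite simple graph with minimum degree $\delta=\delta(G)\ge 2$ and maximum degree $\Delta=\Delta(G)$. Then $\chi_2(G)\le \lceil (4\Delta^2)^{\frac{1}{\delta-1}}\rceil\,\chi(G)$.
   Context: $\chi(G)$ is the chromatic number of $G$. A dynamic coloring of $G$ is a proper vertex coloring such that for every vertex $v$ of degree at least $2$, the neighbours of $v$ receive at least two different colors; $\chi_2(G)$ is the smallest number of colors in a dynamic coloring of $G$. -}

module Defs where

open import Data.Nat using (ℕ; zero; suc; _+_; _*_; _^_; _≤_)
open import Data.Bool using (Bool; true; false; if_then_else_)
open import Data.Fin using (Fin)
open import Data.List using (List; map; allFin)
open import Data.Nat.ListAction using (sum)
open import Data.Product using (Σ; _×_; ∃; ∃-syntax)
open import Relation.Binary.PropositionalEquality using (_≡_; _≢_)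

record Graph : Set where
  field
    n      : ℕ
    adj    : Fin n → Fin n → Bool
    sym    : ∀ u v → adj u v ≡ adj v u
    irrefl : ∀ v → adj v v ≡ false
open Graph public

Adj : (G : Graph) → Fin (n G) → Fin (n G) → Set
Adj G u v = adj G u v ≡ true

degree : (G : Graph) → Fin (n G) → ℕ
degree G v = sum (map (λ u → if adj G v u then 1 else 0) (allFin (n G)))

IsMinDegree : Graph → ℕ → Set
IsMinDegree G d = (∃[ v ] degree G v ≡ d) × (∀ v → d ≤ degree G v)

IsMaxDegree : Graph → ℕ → Set
IsMaxDegree G d = (∃[ v ] degree G v ≡ d) × (∀ v → degree G v ≤ d)

IsProper : (G : Graph) {k : ℕ} → (Fin (n G) → Fin k) → Set
IsProper G c = ∀ u v → Adj G u v → c u ≢ c v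

IsDynamic : (G : Graph) {k : ℕ} → (Fin (n G) → Fin k) → Set
IsDynamic G c = IsProper G c ×
  (∀ v → 2 ≤ degree G v → ∃[ u ] ∃[ w ] (Adj G v u × Adj G v w × c u ≢ c w))

Colourable : Graph → ℕ → Set
Colourable G k = Σ (Fin (n G) → Fin k) (IsProper G)

DynColourable : Graph → ℕ → Set
DynColourable G k = Σ (Fin (n G) → Fin k) (IsDynamic G)

IsChromaticNumber : Graph → ℕ → Set
IsChromaticNumber G k = Colourable G k × (∀ j → Colourable G j → k ≤ j)

IsDynChromaticNumber : Graph → ℕ → Set
IsDynChromaticNumber G k = DynColourable G k × (∀ j → DynColourable G j → k ≤ j)

-- m = ⌈ x^(1/e) ⌉ for e ≥ 1: the least natural m with x ≤ m^e
IsCeilRoot : (e x m : ℕ) → Set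
IsCeilRoot e x m = (x ≤ m ^ e) × (∀ j → x ≤ j ^ e → m ≤ j)

module Submission where

-- χ₂(G) ≤ ⌈(4Δ²)^(1/(δ-1))⌉ · χ(G), by the Lovász Local Lemma turned into counting.
--
-- Colour the vertices with m colours uniformly at random, m = ⌈(4Δ²)^(1/(δ-1))⌉.
-- Let A_v be the event that the neighbourhood N(v) is monochromatic; then
-- Pr(A_v) = m^(1-deg v) ≤ 1/m^(δ-1), and A_v is mutually independent of the
-- events A_u with N(u) ∩ N(v) = ∅.  Weighting A_u by the number of common
-- neighbours of u and v, the total weight of the events dependent on A_v is at
-- most Δ², so the condition 4Δ² ≤ m^(δ-1) of the symmetric local lemma holds
-- and some colouring f avoids every A_v.  Pairing f with an optimal proper
-- colouring c gives the dynamic colouring v ↦ (f v, c v) with m·χ colours.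

open import Defs renaming (sym to adj-sym)
open import Data.Bool using (Bool; true; false; not; _∧_; if_then_else_)
open import Data.Bool.Properties using (∧-conicalˡ; ∧-conicalʳ; not-injective) renaming (_≟_ to _≟ᵇ_)
open import Data.Fin using (Fin; zero; suc; _≟_; combine; remQuot)
open import Data.Fin.Properties using (remQuot-combine; nonZeroIndex)
open import Data.List using (List; []; _∷_; length; filter; allFin; tabulate; map)
open import Data.Bool.ListAction using (all)
open import Data.List.Membership.Propositional using (_∈_)
open import Data.List.Membership.Propositional.Properties using (∈-filter⁻; ∈-allFin)
open import Data.List.Properties using (map-tabulate; filter-notAll)
open import Data.List.Relation.Unary.All as All using (All; []; _∷_; all?)
open import Data.List.Relation.Unary.All.Properties using (all-filter)
open import Data.List.Relation.Unary.All.Properties.Core using (¬All⇒Any¬)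
open import Data.List.Relation.Unary.AllPairs using (_∷_)
open import Data.List.Relation.Unary.Any using (here; there)
open import Data.List.Relation.Unary.Unique.Propositional using (Unique)
open import Data.List.Relation.Unary.Unique.Propositional.Properties using (allFin⁺; filter⁺)
open import Data.Nat
  using (ℕ; zero; suc; _+_; _*_; _∸_; _^_; _≤_; z≤n; s≤s; s≤s⁻¹; NonZero; >-nonZero)
  renaming (_≟_ to _≟ℕ_)
open import Data.Nat.ListAction using () renaming (sum to sumList)
open import Data.Nat.Properties hiding (_≟_)
open import Algebra.Properties.Semiring.Sum +-*-semiring
  using (sum; sum-syntax; sum-cong-≗; ∑-distrib-+; ∑-comm; *-distribˡ-sum; *-distribʳ-sum; sum-remove)
open import Data.Nat.Tactic.RingSolver using (solve-∀)
open import Data.Product using (_×_; _,_; proj₁; proj₂; ∃-syntax)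
open import Data.Vec using (Vec; []; _∷_; lookup; _[_]≔_)
open import Data.Vec.Properties using (lookup∘updateAt; lookup∘updateAt′)
open import Data.Vec.Functional using (Vector)
open import Function using (_∘_)
open import Relation.Binary.PropositionalEquality
  using (_≡_; _≢_; refl; sym; trans; cong; cong₂; subst; module ≡-Reasoning)
open import Relation.Nullary using (¬_; yes; no; does; contradiction)
open import Relation.Unary using (Pred; Decidable)

-- The 0/1 indicator of a boolean (the same expression the degree is built from).
𝟙 : Bool → ℕ
𝟙 b = if b then 1 else 0

𝟙-mono : ∀ {a b} → (a ≡ true → b ≡ true) → 𝟙 a ≤ 𝟙 b
𝟙-mono {false} _ = z≤n
𝟙-mono {true} a⇒b rewrite a⇒b refl = ≤-refl

𝟙-true : ∀ {b} → 1 ≤ 𝟙 b → b ≡ true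
𝟙-true {true} _ = refl

𝟙-∧ : ∀ a b c → 𝟙 (a ∧ b) * c ≡ 𝟙 a * (𝟙 b * c)
𝟙-∧ true b c = sym (*-identityˡ (𝟙 b * c))
𝟙-∧ false b c = refl

𝟙-split : ∀ a b → 𝟙 b ≡ 𝟙 (not a ∧ b) + 𝟙 a * 𝟙 b
𝟙-split true true = refl
𝟙-split true false = refl
𝟙-split false true = refl
𝟙-split false false = refl

∑-mono : ∀ {n} {f g : Vector ℕ n} → (∀ i → f i ≤ g i) → sum f ≤ sum g
∑-mono {zero} _ = z≤n
∑-mono {suc n} f≤g = +-mono-≤ (f≤g zero) (∑-mono (f≤g ∘ suc))

∑-const : ∀ n a → ∑[ i < n ] a ≡ n * a
∑-const zero a = refl
∑-const (suc n) a = cong (a +_) (∑-const n a)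

term≤∑ : ∀ {n} (f : Vector ℕ n) i → f i ≤ sum f
term≤∑ {suc n} f i = ≤-trans (m≤m+n (f i) _) (≤-reflexive (sym (sum-remove {i = i} f)))

∑-witness : ∀ {n} (f : Vector ℕ n) → 1 ≤ sum f → ∃[ i ] 1 ≤ f i
∑-witness {suc n} f 1≤∑ with f zero ≟ℕ 0
... | no f₀≢0 = zero , n≢0⇒n>0 f₀≢0
... | yes f₀≡0 with ∑-witness (f ∘ suc) (subst (λ a → 1 ≤ a + sum (f ∘ suc)) f₀≡0 1≤∑)
...   | i , 1≤fᵢ = suc i , 1≤fᵢ

∑-weighted : ∀ {n} K (w x : Vector ℕ n) → (∀ u → x u ≤ K) →
  ∑[ u < n ] (w u * x u) ≤ sum w * K
∑-weighted K w x x≤K = ≤-trans (∑-mono (λ u → *-monoʳ-≤ (w u) (x≤K u)))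
                                (≤-reflexive (sym (*-distribʳ-sum K w)))

∑-scale : ∀ {n} q (w x : Vector ℕ n) → q * ∑[ u < n ] (w u * x u) ≡ ∑[ u < n ] (w u * (q * x u))
∑-scale q w x = trans (*-distribˡ-sum q (λ u → w u * x u)) (sum-cong-≗ (λ u → x*y*z≡y*x*z q (w u) (x u)))
  where
  x*y*z≡y*x*z : ∀ a b c → a * (b * c) ≡ b * (a * c)
  x*y*z≡y*x*z = solve-∀

∑-𝟙-≟ : ∀ {m} (a : Fin m) → ∑[ c < m ] 𝟙 (does (c ≟ a)) ≡ 1
∑-𝟙-≟ {suc m} zero = cong suc (trans (∑-const m 0) (*-zeroʳ m))
∑-𝟙-≟ {suc m} (suc a) = ∑-𝟙-≟ a

sumList-tabulate : ∀ {n} (h : Fin n → ℕ) → sumList (tabulate h) ≡ sum h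
sumList-tabulate {zero} h = refl
sumList-tabulate {suc n} h = cong (h zero +_) (sumList-tabulate (h ∘ suc))

absorb : ∀ {q D a b X} .{{_ : NonZero q}} → 4 * D ≤ q →
  a ≤ b + X → q * X ≤ D * (2 * a) → a ≤ 2 * b
absorb {q} {D} {a} {b} {X} 4D≤q a≤b+X qX≤2Da =
  *-cancelˡ-≤ q (+-cancelʳ-≤ (q * a) (q * a) (q * (2 * b)) (begin
    q * a + q * a                               ≤⟨ +-mono-≤ qa≤ qa≤ ⟩
    (q * b + q * X) + (q * b + q * X)           ≡⟨ regroup q b X ⟩
    q * (2 * b) + (q * X + q * X)               ≤⟨ +-monoʳ-≤ (q * (2 * b)) (+-mono-≤ qX≤2Da qX≤2Da) ⟩
    q * (2 * b) + (D * (2 * a) + D * (2 * a))   ≡⟨ cong (q * (2 * b) +_) (double D a) ⟩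
    q * (2 * b) + 4 * D * a                     ≤⟨ +-monoʳ-≤ (q * (2 * b)) (*-monoˡ-≤ a 4D≤q) ⟩
    q * (2 * b) + q * a                         ∎))
  where
  open ≤-Reasoning
  qa≤ : q * a ≤ q * b + q * X
  qa≤ = ≤-trans (*-monoʳ-≤ q a≤b+X) (≤-reflexive (*-distribˡ-+ q b X))
  regroup : ∀ q b X → (q * b + q * X) + (q * b + q * X) ≡ q * (2 * b) + (q * X + q * X)
  regroup = solve-∀
  double : ∀ D a → D * (2 * a) + D * (2 * a) ≡ 4 * D * a
  double = solve-∀

remainder-positive : ∀ {q a b c} → 4 ≤ q → 1 ≤ a → a ≡ b + c → q * c ≤ 2 * a → 1 ≤ b
remainder-positive {b = suc _} _ _ _ _ = s≤s z≤n
remainder-positive {b = zero} {c = c} 4≤q 1≤c refl qc≤2c =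
  contradiction (*-cancelʳ-≤ 4 2 c {{>-nonZero 1≤c}} (≤-trans (*-monoˡ-≤ c 4≤q) qc≤2c))
                λ { (s≤s (s≤s ())) }

colour-exists : ∀ {m e} → 1 ≤ e → 1 ≤ m ^ e → Fin m
colour-exists {suc _} _ _ = zero
colour-exists {zero} {suc _} _ ()

-- The key fact is count-monochromatic: a list L of distinct points is
-- monochromatic for exactly an m^(1-|L|) fraction of the colourings, even when
-- weighted by any h that does not look at the colours of L.
module Colourings (m : ℕ) where

  Colouring : ℕ → Set
  Colouring = Vec (Fin m)

  count : ∀ {n} → (Colouring n → ℕ) → ℕ
  count {zero} h = h []
  count {suc n} h = ∑[ c < m ] count (h ∘ (c ∷_))

  count-cong : ∀ {n} {h h′ : Colouring n → ℕ} → (∀ f → h f ≡ h′ f) → count h ≡ count h′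
  count-cong {zero} h≡h′ = h≡h′ []
  count-cong {suc n} h≡h′ = sum-cong-≗ (λ c → count-cong (λ g → h≡h′ (c ∷ g)))

  count-mono : ∀ {n} {h h′ : Colouring n → ℕ} → (∀ f → h f ≤ h′ f) → count h ≤ count h′
  count-mono {zero} h≤h′ = h≤h′ []
  count-mono {suc n} h≤h′ = ∑-mono (λ c → count-mono (λ g → h≤h′ (c ∷ g)))

  count-+ : ∀ {n} (h h′ : Colouring n → ℕ) → count (λ f → h f + h′ f) ≡ count h + count h′
  count-+ {zero} h h′ = refl
  count-+ {suc n} h h′ = trans (sum-cong-≗ (λ c → count-+ (h ∘ (c ∷_)) (h′ ∘ (c ∷_))))
    (∑-distrib-+ (λ c → count (h ∘ (c ∷_))) (λ c → count (h′ ∘ (c ∷_))))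

  count-*ˡ : ∀ {n} a (h : Colouring n → ℕ) → count (λ f → a * h f) ≡ a * count h
  count-*ˡ {zero} a h = refl
  count-*ˡ {suc n} a h = trans (sum-cong-≗ (λ c → count-*ˡ a (h ∘ (c ∷_))))
    (sym (*-distribˡ-sum a (λ c → count (h ∘ (c ∷_)))))

  count-∑ : ∀ {n s} (H : Fin s → Colouring n → ℕ) →
    count (λ f → ∑[ i < s ] H i f) ≡ ∑[ i < s ] count (H i)
  count-∑ {zero} H = refl
  count-∑ {suc n} H = trans (sum-cong-≗ (λ c → count-∑ (λ i → H i ∘ (c ∷_))))
    (∑-comm (λ c i → count (H i ∘ (c ∷_))))

  count-pos : ∀ {n} → Fin m → 1 ≤ count {n} (λ _ → 1)
  count-pos {zero} c₀ = ≤-refl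
  count-pos {suc n} c₀ = ≤-trans (count-pos {n} c₀) (term≤∑ (λ _ → count {n} (λ _ → 1)) c₀)

  count-witness : ∀ {n} (h : Colouring n → ℕ) → 1 ≤ count h → ∃[ f ] 1 ≤ h f
  count-witness {zero} h 1≤h = [] , 1≤h
  count-witness {suc n} h 1≤count with ∑-witness _ 1≤count
  ... | c , 1≤c with count-witness _ 1≤c
  ...   | g , 1≤g = c ∷ g , 1≤g

  count-resample : ∀ {n} (x : Fin n) (h : Colouring n → ℕ) →
    count (λ f → ∑[ c < m ] h (f [ x ]≔ c)) ≡ m * count h
  count-resample zero h = begin
    ∑[ c₀ < m ] count (λ g → ∑[ c < m ] h (c ∷ g))
      ≡⟨ sum-cong-≗ {m} (λ _ → count-∑ (λ c → h ∘ (c ∷_))) ⟩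
    ∑[ c₀ < m ] count h
      ≡⟨ ∑-const m (count h) ⟩
    m * count h ∎
    where open ≡-Reasoning
  count-resample (suc x) h =
    trans (sum-cong-≗ (λ c₀ → count-resample x (h ∘ (c₀ ∷_))))
          (sym (*-distribˡ-sum m (λ c₀ → count (h ∘ (c₀ ∷_)))))

  Ignores : ∀ {n} → Fin n → (Colouring n → ℕ) → Set
  Ignores y h = ∀ f c → h (f [ y ]≔ c) ≡ h f

  agree : ∀ {n} → Colouring n → Fin n → Fin n → Bool
  agree f y x = does (lookup f y ≟ lookup f x)

  count-agree : ∀ {n} {x y : Fin n} (h : Colouring n → ℕ) → y ≢ x → Ignores y h →
    m * count (λ f → 𝟙 (agree f y x) * h f) ≡ count h
  count-agree {x = x} {y} h y≢x h-ignores-y = begin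
    m * count (λ f → 𝟙 (agree f y x) * h f)
      ≡⟨ sym (count-resample y _) ⟩
    count (λ f → ∑[ c < m ] (𝟙 (agree (f [ y ]≔ c) y x) * h (f [ y ]≔ c)))
      ≡⟨ count-cong (λ f → sum-cong-≗ (λ c → cong₂ _*_ (recoloured f c) (h-ignores-y f c))) ⟩
    count (λ f → ∑[ c < m ] (𝟙 (does (c ≟ lookup f x)) * h f))
      ≡⟨ count-cong (λ f → sym (*-distribʳ-sum (h f) (λ c → 𝟙 (does (c ≟ lookup f x))))) ⟩
    count (λ f → (∑[ c < m ] 𝟙 (does (c ≟ lookup f x))) * h f)
      ≡⟨ count-cong (λ f → trans (cong (_* h f) (∑-𝟙-≟ (lookup f x))) (*-identityˡ (h f))) ⟩
    count h ∎
    where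
    open ≡-Reasoning
    recoloured : ∀ f c → 𝟙 (agree (f [ y ]≔ c) y x) ≡ 𝟙 (does (c ≟ lookup f x))
    recoloured f c = cong₂ (λ a b → 𝟙 (does (a ≟ b)))
      (lookup∘updateAt y f) (lookup∘updateAt′ x y (y≢x ∘ sym) f)

  allAgree : ∀ {n} → Colouring n → Fin n → List (Fin n) → Bool
  allAgree f x = all (λ y → agree f y x)

  monochromatic : ∀ {n} → Colouring n → List (Fin n) → Bool
  monochromatic f [] = true
  monochromatic f (x ∷ Y) = allAgree f x Y

  monochromatic-local : ∀ {n} {f g : Colouring n} L →
    All (λ y → lookup f y ≡ lookup g y) L → monochromatic f L ≡ monochromatic g L
  monochromatic-local [] _ = refl
  monochromatic-local {f = f} {g} (x ∷ Y) (fx≡gx ∷ fY≡gY) = agree-local Y fY≡gY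
    where
    agree-local : ∀ Y → All (λ y → lookup f y ≡ lookup g y) Y → allAgree f x Y ≡ allAgree g x Y
    agree-local [] [] = refl
    agree-local (y ∷ Y) (fy≡gy ∷ fY≡gY) =
      cong₂ _∧_ (cong₂ (λ a b → does (a ≟ b)) fy≡gy fx≡gx) (agree-local Y fY≡gY)

  monochromatic-ignores : ∀ {n} {y : Fin n} L → All (y ≢_) L →
    ∀ f c → monochromatic (f [ y ]≔ c) L ≡ monochromatic f L
  monochromatic-ignores {y = y} L y∉L f c =
    monochromatic-local L (All.map (λ y≢z → lookup∘updateAt′ _ y (y≢z ∘ sym) f) y∉L)

  count-allAgree : ∀ {n} x (Y : List (Fin n)) (h : Colouring n → ℕ) → Unique (x ∷ Y) →
    All (λ y → Ignores y h) Y → m ^ length Y * count (λ f → 𝟙 (allAgree f x Y) * h f) ≡ count h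
  count-allAgree x [] h _ _ = trans (*-identityˡ _) (count-cong (λ f → *-identityˡ (h f)))
  count-allAgree x (y ∷ Y) h ((x≢y ∷ x∉Y) ∷ y∉Y ∷ Y-unique) (h-ignores-y ∷ h-ignores-Y) = begin
    m ^ suc (length Y) * count (λ f → 𝟙 (agree f y x ∧ allAgree f x Y) * h f)
      ≡⟨ cong₂ _*_ (*-comm m _) (count-cong (λ f → 𝟙-∧ (agree f y x) _ (h f))) ⟩
    m ^ length Y * m * count (λ f → 𝟙 (agree f y x) * rest f)
      ≡⟨ *-assoc (m ^ length Y) m _ ⟩
    m ^ length Y * (m * count (λ f → 𝟙 (agree f y x) * rest f))
      ≡⟨ cong (m ^ length Y *_) (count-agree rest (x≢y ∘ sym) rest-ignores-y) ⟩
    m ^ length Y * count rest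
      ≡⟨ count-allAgree x Y h (x∉Y ∷ Y-unique) h-ignores-Y ⟩
    count h ∎
    where
    open ≡-Reasoning
    rest : Colouring _ → ℕ
    rest f = 𝟙 (allAgree f x Y) * h f
    rest-ignores-y : Ignores y rest
    rest-ignores-y f c = cong₂ _*_
      (cong 𝟙 (monochromatic-ignores (x ∷ Y) ((x≢y ∘ sym) ∷ y∉Y) f c)) (h-ignores-y f c)

  count-monochromatic : ∀ {n} (L : List (Fin n)) (h : Colouring n → ℕ) → Unique L →
    All (λ y → Ignores y h) L → m ^ (length L ∸ 1) * count (λ f → 𝟙 (monochromatic f L) * h f) ≡ count h
  count-monochromatic [] h _ _ = trans (*-identityˡ _) (count-cong (λ f → *-identityˡ (h f)))
  count-monochromatic (x ∷ Y) h L-unique (_ ∷ h-ignores-Y) = count-allAgree x Y h L-unique h-ignores-Y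

  disagreement : ∀ {n} (f : Colouring n) x Y → allAgree f x Y ≡ false →
    ∃[ y ] (y ∈ Y × lookup f y ≢ lookup f x)
  disagreement f x (y ∷ Y) mixed with lookup f y ≟ lookup f x
  ... | no fy≢fx = y , here refl , fy≢fx
  ... | yes _ = let z , z∈Y , fz≢fx = disagreement f x Y mixed in z , there z∈Y , fz≢fx

  not-monochromatic : ∀ {n} {f : Colouring n} L → monochromatic f L ≡ false →
    ∃[ x ] ∃[ y ] (x ∈ L × y ∈ L × lookup f x ≢ lookup f y)
  not-monochromatic {f = f} (x ∷ Y) mixed =
    let y , y∈Y , fy≢fx = disagreement f x Y mixed in y , x , there y∈Y , here refl , fy≢fx

module Avoidance {Ω : Set} {k : ℕ} (A : Fin k → Ω → Bool) where

  avoids : List (Fin k) → Ω → Bool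
  avoids T f = all (λ u → not (A u f)) T

  avoids-cong : ∀ {f g} T → All (λ u → A u f ≡ A u g) T → avoids T f ≡ avoids T g
  avoids-cong [] [] = refl
  avoids-cong (u ∷ T) (Au≡ ∷ AT≡) = cong₂ (λ a b → not a ∧ b) Au≡ (avoids-cong T AT≡)

  avoids-∈ : ∀ {f u T} → avoids T f ≡ true → u ∈ T → A u f ≡ false
  avoids-∈ av (here refl) = not-injective (∧-conicalˡ _ _ av)
  avoids-∈ av (there u∈T) = avoids-∈ (∧-conicalʳ _ _ av) u∈T

  module _ {ℓ} {P : Pred (Fin k) ℓ} (P? : Decidable P) where

    avoids-filter : ∀ T f → avoids T f ≡ true → avoids (filter P? T) f ≡ true
    avoids-filter [] f _ = refl
    avoids-filter (u ∷ T) f av with does (P? u)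
    ... | true = cong₂ _∧_ (∧-conicalˡ _ _ av) (avoids-filter T f (∧-conicalʳ _ _ av))
    ... | false = avoids-filter T f (∧-conicalʳ _ _ av)

    culprit : ∀ T f → avoids (filter P? T) f ≡ true → avoids T f ≡ false →
      ∃[ u ] (¬ P u × A u f ≡ true)
    culprit (u ∷ T) f kept missed with P? u
    ... | yes _ with A u f
    ...   | true = contradiction kept λ ()
    ...   | false = culprit T f kept missed
    culprit (u ∷ T) f kept missed | no ¬Pu with A u f in Au
    ...   | true = u , ¬Pu , Au
    ...   | false = culprit T f kept missed

open Avoidance using (avoids; avoids-cong; avoids-∈; avoids-filter; culprit)

-- Events A_v (v : Fin k), weights dep v u that vanish when A_u does not
-- influence A_v, total dependency weight at most D, and each A_v having
-- conditional weight at most 1/q against any family of events independent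
-- of it.
module LocalLemma
    {Ω : Set} (E : (Ω → ℕ) → ℕ)
    (E-mono : ∀ {h h′} → (∀ f → h f ≤ h′ f) → E h ≤ E h′)
    (E-+ : ∀ h h′ → E (λ f → h f + h′ f) ≡ E h + E h′)
    (E-*ˡ : ∀ a h → E (λ f → a * h f) ≡ a * E h)
    (E-∑ : ∀ {s} (H : Fin s → Ω → ℕ) → E (λ f → ∑[ i < s ] H i f) ≡ ∑[ i < s ] E (H i))
    (E-pos : 1 ≤ E (λ _ → 1))
    {k : ℕ} (A : Fin k → Ω → Bool) (dep : Fin k → Fin k → ℕ) (D q : ℕ)
    (dep-bound : ∀ v → ∑[ u < k ] dep v u ≤ D)
    (D-pos : 1 ≤ D) (q-large : 4 * D ≤ q)
    (independence : ∀ v T → All (λ u → dep v u ≡ 0) T →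
      q * E (λ f → 𝟙 (A v f) * 𝟙 (avoids A T f)) ≤ E (λ f → 𝟙 (avoids A T f)))
  where

  E-cong : ∀ {h h′} → (∀ f → h f ≡ h′ f) → E h ≡ E h′
  E-cong h≡h′ = ≤-antisym (E-mono (≤-reflexive ∘ h≡h′)) (E-mono (λ f → ≤-reflexive (sym (h≡h′ f))))

  4≤q : 4 ≤ q
  4≤q = ≤-trans (*-monoʳ-≤ 4 D-pos) q-large

  instance
    q-nonZero : NonZero q
    q-nonZero = >-nonZero (≤-trans (s≤s z≤n) 4≤q)

  Avoid : List (Fin k) → ℕ
  Avoid T = E (λ f → 𝟙 (avoids A T f))

  Hit : Fin k → List (Fin k) → ℕ
  Hit v T = E (λ f → 𝟙 (A v f) * 𝟙 (avoids A T f))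

  independent? : ∀ v → Decidable (λ u → dep v u ≡ 0)
  independent? v u = dep v u ≟ℕ 0

  IndepPart : Fin k → List (Fin k) → List (Fin k)
  IndepPart v = filter (independent? v)

  union-bound : ∀ v T f → 𝟙 (avoids A (IndepPart v T) f) ≤
    𝟙 (avoids A T f) + ∑[ u < k ] (dep v u * (𝟙 (A u f) * 𝟙 (avoids A (IndepPart v T) f)))
  union-bound v T f with avoids A (IndepPart v T) f in kept | avoids A T f in missed
  ... | false | _ = z≤n
  ... | true | true = s≤s z≤n
  ... | true | false with culprit A (independent? v) T f kept missed
  ...   | u , dep≢0 , Au = ≤-trans (occurs u dep≢0 Au) (≤-trans (term≤∑ _ u) (m≤n+m _ _))
    where
    occurs : ∀ u → dep v u ≢ 0 → A u f ≡ true → 1 ≤ dep v u * (𝟙 (A u f) * 1)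
    occurs u dep≢0 Au rewrite Au | *-identityʳ (dep v u) = n≢0⇒n>0 dep≢0

  reduction : ∀ v T → (∀ u → q * Hit u (IndepPart v T) ≤ 2 * Avoid (IndepPart v T)) →
    q * Hit v T ≤ 2 * Avoid T
  reduction v T ih = ≤-trans hit≤avoid₁ (absorb {D = D} q-large union dependent)
    where
    open ≤-Reasoning
    T₁ = IndepPart v T
    hit≤avoid₁ : q * Hit v T ≤ Avoid T₁
    hit≤avoid₁ = ≤-trans
      (*-monoʳ-≤ q (E-mono (λ f → *-monoʳ-≤ (𝟙 (A v f)) (𝟙-mono (avoids-filter A (independent? v) T f)))))
      (independence v T₁ (all-filter (independent? v) T))
    union : Avoid T₁ ≤ Avoid T + ∑[ u < k ] (dep v u * Hit u T₁)
    union = begin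
      Avoid T₁
        ≤⟨ E-mono (union-bound v T) ⟩
      E (λ f → 𝟙 (avoids A T f) + ∑[ u < k ] (dep v u * (𝟙 (A u f) * 𝟙 (avoids A T₁ f))))
        ≡⟨ E-+ _ _ ⟩
      Avoid T + E (λ f → ∑[ u < k ] (dep v u * (𝟙 (A u f) * 𝟙 (avoids A T₁ f))))
        ≡⟨ cong (Avoid T +_) (E-∑ (λ u f → dep v u * (𝟙 (A u f) * 𝟙 (avoids A T₁ f)))) ⟩
      Avoid T + ∑[ u < k ] E (λ f → dep v u * (𝟙 (A u f) * 𝟙 (avoids A T₁ f)))
        ≡⟨ cong (Avoid T +_) (sum-cong-≗ (λ u → E-*ˡ (dep v u) _)) ⟩
      Avoid T + ∑[ u < k ] (dep v u * Hit u T₁) ∎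
    dependent : q * ∑[ u < k ] (dep v u * Hit u T₁) ≤ D * (2 * Avoid T₁)
    dependent = begin
      q * ∑[ u < k ] (dep v u * Hit u T₁)      ≡⟨ ∑-scale q (dep v) (λ u → Hit u T₁) ⟩
      ∑[ u < k ] (dep v u * (q * Hit u T₁))    ≤⟨ ∑-weighted _ (dep v) _ ih ⟩
      (∑[ u < k ] dep v u) * (2 * Avoid T₁)  ≤⟨ *-monoˡ-≤ _ (dep-bound v) ⟩
      D * (2 * Avoid T₁)                     ∎

  conditional-bound : ∀ T v → q * Hit v T ≤ 2 * Avoid T
  conditional-bound T = bound (length T) T ≤-refl
    where
    from-independence : ∀ v T → All (λ u → dep v u ≡ 0) T → q * Hit v T ≤ 2 * Avoid T
    from-independence v T T-indep = ≤-trans (independence v T T-indep) (m≤m+n _ _)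
    bound : ∀ r T → length T ≤ r → ∀ v → q * Hit v T ≤ 2 * Avoid T
    bound zero [] _ v = from-independence v [] []
    bound (suc r) T |T|≤1+r v with all? (independent? v) T
    ... | yes T-indep = from-independence v T T-indep
    ... | no T-dep = reduction v T (bound r (IndepPart v T) |T₁|≤r)
      where
      |T₁|≤r : length (IndepPart v T) ≤ r
      |T₁|≤r = s≤s⁻¹ (≤-trans
        (filter-notAll (independent? v) T (¬All⇒Any¬ (independent? v) T T-dep)) |T|≤1+r)

  local-lemma : ∀ T → 1 ≤ Avoid T
  local-lemma [] = E-pos
  local-lemma (v ∷ T) = remainder-positive 4≤q (local-lemma T) split (conditional-bound T v)
    where
    split : Avoid T ≡ Avoid (v ∷ T) + Hit v T
    split = trans (E-cong (λ f → 𝟙-split (A v f) (avoids A T f))) (E-+ _ _)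

module Neighbourhoods (G : Graph) where

  V : Set
  V = Fin (n G)

  Adj? : ∀ v → Decidable (Adj G v)
  Adj? v u = adj G v u ≟ᵇ true

  neighbours : V → List V
  neighbours v = filter (Adj? v) (allFin (n G))

  neighbours-unique : ∀ v → Unique (neighbours v)
  neighbours-unique v = filter⁺ (Adj? v) (allFin⁺ (n G))

  neighbours-adjacent : ∀ v {u} → u ∈ neighbours v → Adj G v u
  neighbours-adjacent v u∈ = proj₂ (∈-filter⁻ (Adj? v) {xs = allFin (n G)} u∈)

  length-neighbours : ∀ v → length (neighbours v) ≡ degree G v
  length-neighbours v = counted (allFin (n G))
    where
    counted : ∀ xs → length (filter (Adj? v) xs) ≡ sumList (map (λ u → 𝟙 (adj G v u)) xs)
    counted [] = refl
    counted (x ∷ xs) with adj G v x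
    ... | true = cong suc (counted xs)
    ... | false = counted xs

  degree-∑ : ∀ v → degree G v ≡ ∑[ u < n G ] 𝟙 (adj G v u)
  degree-∑ v = trans (cong sumList (map-tabulate (λ u → u) (λ u → 𝟙 (adj G v u))))
                     (sumList-tabulate (λ u → 𝟙 (adj G v u)))

  common : V → V → ℕ
  common v u = ∑[ w < n G ] (𝟙 (adj G v w) * 𝟙 (adj G u w))

  no-common-neighbour : ∀ {v u w} → common v u ≡ 0 → Adj G v w → ¬ Adj G u w
  no-common-neighbour {v} {u} {w} none vw uw =
    contradiction (subst (1 ≤_) none (≤-trans one (term≤∑ _ w))) λ ()
    where
    one : 1 ≤ 𝟙 (adj G v w) * 𝟙 (adj G u w)
    one rewrite vw | uw = ≤-refl

  -- Summed over u, common neighbours count the walks v – w – u.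
  ∑-common : ∀ v → ∑[ u < n G ] common v u ≡ ∑[ w < n G ] (𝟙 (adj G v w) * degree G w)
  ∑-common v = begin
    ∑[ u < n G ] ∑[ w < n G ] (𝟙 (adj G v w) * 𝟙 (adj G u w))
      ≡⟨ ∑-comm (λ u w → 𝟙 (adj G v w) * 𝟙 (adj G u w)) ⟩
    ∑[ w < n G ] ∑[ u < n G ] (𝟙 (adj G v w) * 𝟙 (adj G u w))
      ≡⟨ sum-cong-≗ (λ w → sym (*-distribˡ-sum (𝟙 (adj G v w)) (λ u → 𝟙 (adj G u w)))) ⟩
    ∑[ w < n G ] (𝟙 (adj G v w) * ∑[ u < n G ] 𝟙 (adj G u w))
      ≡⟨ sum-cong-≗ (λ w → cong (𝟙 (adj G v w) *_) (deg w)) ⟩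
    ∑[ w < n G ] (𝟙 (adj G v w) * degree G w) ∎
    where
    open ≡-Reasoning
    deg : ∀ w → ∑[ u < n G ] 𝟙 (adj G u w) ≡ degree G w
    deg w = trans (sum-cong-≗ (λ u → cong 𝟙 (adj-sym G u w))) (sym (degree-∑ w))

  dependency-bound : ∀ {Δ} → (∀ v → degree G v ≤ Δ) → ∀ v → ∑[ u < n G ] common v u ≤ Δ * Δ
  dependency-bound {Δ} Δ-max v = begin
    ∑[ u < n G ] common v u                    ≡⟨ ∑-common v ⟩
    ∑[ w < n G ] (𝟙 (adj G v w) * degree G w)    ≤⟨ ∑-weighted Δ _ _ Δ-max ⟩
    (∑[ w < n G ] 𝟙 (adj G v w)) * Δ           ≡⟨ cong (_* Δ) (sym (degree-∑ v)) ⟩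
    degree G v * Δ                             ≤⟨ *-monoˡ-≤ Δ (Δ-max v) ⟩
    Δ * Δ                                      ∎
    where open ≤-Reasoning

module RainbowNeighbourhoods (G : Graph) (m : ℕ) where
  open Neighbourhoods G
  open Colourings m

  Bad : V → Colouring (n G) → Bool
  Bad v f = monochromatic f (neighbours v)

  bad-ignores : ∀ {v u x} → common v u ≡ 0 → Adj G v x → ∀ f c → Bad u (f [ x ]≔ c) ≡ Bad u f
  bad-ignores {v} {u} none vx = monochromatic-ignores (neighbours u)
    (All.tabulate (λ y∈ x≡y →
      no-common-neighbour none vx (subst (Adj G u) (sym x≡y) (neighbours-adjacent u y∈))))

  -- Bad v has conditional weight ≤ 1/m^(δ-1) against events without
  -- common neighbours with v, since those ignore all colours on N(v).
  bad-independence : ∀ {δ} .{{_ : NonZero m}} → (∀ v → δ ≤ degree G v) →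
    ∀ v T → All (λ u → common v u ≡ 0) T →
    m ^ (δ ∸ 1) * count (λ f → 𝟙 (Bad v f) * 𝟙 (avoids Bad T f)) ≤ count (λ f → 𝟙 (avoids Bad T f))
  bad-independence {δ} δ-min v T T-indep = begin
    m ^ (δ ∸ 1) * count (λ f → 𝟙 (Bad v f) * 𝟙 (avoids Bad T f))
      ≤⟨ *-monoˡ-≤ _ (^-monoʳ-≤ m (∸-monoˡ-≤ 1 δ≤|N|)) ⟩
    m ^ (length (neighbours v) ∸ 1) * count (λ f → 𝟙 (Bad v f) * 𝟙 (avoids Bad T f))
      ≡⟨ count-monochromatic (neighbours v) _ (neighbours-unique v) ignores ⟩
    count (λ f → 𝟙 (avoids Bad T f)) ∎
    where
    open ≤-Reasoning
    δ≤|N| : δ ≤ length (neighbours v)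
    δ≤|N| = subst (δ ≤_) (sym (length-neighbours v)) (δ-min v)
    ignores : All (λ y → Ignores y (λ f → 𝟙 (avoids Bad T f))) (neighbours v)
    ignores = All.tabulate (λ x∈ f c → cong 𝟙 (avoids-cong Bad T
      (All.map (λ none → bad-ignores none (neighbours-adjacent v x∈) f c) T-indep)))

  good-colouring : ∀ {δ Δ} → (∀ v → δ ≤ degree G v) → (∀ v → degree G v ≤ Δ) → 2 ≤ δ → 1 ≤ Δ →
    4 * (Δ * Δ) ≤ m ^ (δ ∸ 1) → ∃[ f ] ∀ v → Bad v f ≡ false
  good-colouring {δ} {Δ} δ-min Δ-max 2≤δ 1≤Δ large =
    let f , avoids-all = count-witness _ (L.local-lemma (allFin (n G)))
    in f , λ v → avoids-∈ Bad (𝟙-true avoids-all) (∈-allFin v)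
    where
    c₀ : Fin m
    c₀ = colour-exists (∸-monoˡ-≤ 1 2≤δ)
      (≤-trans (*-mono-≤ {1} {4} (s≤s z≤n) (*-mono-≤ 1≤Δ 1≤Δ)) large)
    instance
      m-nonZero : NonZero m
      m-nonZero = nonZeroIndex c₀
    module L = LocalLemma (count {n G}) count-mono count-+ count-*ˡ count-∑ (count-pos {n G} c₀)
      Bad common (Δ * Δ) (m ^ (δ ∸ 1)) (dependency-bound Δ-max) (*-mono-≤ 1≤Δ 1≤Δ) large
      (bad-independence δ-min)

  rainbow : ∀ {δ Δ} → (∀ v → δ ≤ degree G v) → (∀ v → degree G v ≤ Δ) → 2 ≤ δ → 1 ≤ Δ →
    4 * (Δ * Δ) ≤ m ^ (δ ∸ 1) →
    ∃[ f ] ∀ v → ∃[ x ] ∃[ y ] (Adj G v x × Adj G v y × lookup f x ≢ lookup f y)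
  rainbow δ-min Δ-max 2≤δ 1≤Δ large =
    let f , good = good-colouring δ-min Δ-max 2≤δ 1≤Δ large in
    f , λ v → let x , y , x∈ , y∈ , fx≢fy = not-monochromatic (neighbours v) (good v)
              in x , y , neighbours-adjacent v x∈ , neighbours-adjacent v y∈ , fx≢fy

combine-injective : ∀ {a b} {i i′ : Fin a} {j j′ : Fin b} →
  combine i j ≡ combine i′ j′ → i ≡ i′ × j ≡ j′
combine-injective {a} {b} {i} {i′} {j} {j′} eq =
  cong proj₁ same , cong proj₂ same
  where
  same = trans (sym (remQuot-combine i j)) (trans (cong (remQuot {a} b) eq) (remQuot-combine i′ j′))

dynamic-product : ∀ (G : Graph) {k m} (c : Fin (n G) → Fin k) (f : Fin (n G) → Fin m) → IsProper G c →
  (∀ v → ∃[ x ] ∃[ y ] (Adj G v x × Adj G v y × f x ≢ f y)) →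
  IsDynamic G (λ v → combine (f v) (c v))
dynamic-product G {m = m} c f c-proper f-rainbow =
  (λ u v uv eq → c-proper u v uv (proj₂ (combine-injective {m} eq))) ,
  (λ v _ → let (x , y , vx , vy , fx≢fy) = f-rainbow v
           in x , y , vx , vy , (fx≢fy ∘ proj₁ ∘ combine-injective {m}))

lemma9 : (G : Graph) (δ Δ χ χ₂ m : ℕ) →
    IsMinDegree G δ → IsMaxDegree G Δ → 2 ≤ δ →
    IsChromaticNumber G χ → IsDynChromaticNumber G χ₂ →
    IsCeilRoot (δ ∸ 1) (4 * (Δ * Δ)) m →
    χ₂ ≤ m * χ
lemma9 G δ Δ χ χ₂ m ((v₀ , _) , δ-min) (_ , Δ-max) 2≤δ ((c , c-proper) , _) (_ , χ₂-least) (large , _) =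
  let f , f-rainbow = RainbowNeighbourhoods.rainbow G m δ-min Δ-max 2≤δ 1≤Δ large
  in χ₂-least (m * χ) (_ , dynamic-product G c (lookup f) c-proper f-rainbow)
  where
  1≤Δ : 1 ≤ Δ
  1≤Δ = ≤-trans (≤-trans (s≤s z≤n) 2≤δ) (≤-trans (δ-min v₀) (Δ-max v₀))
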